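{- Let $\mathcal G=(G,\lambda)$ be a temporal graph with $n$ vertices and let $(s_1,z_1),\dots,(s_k,z_k)$ be terminal pairs. Suppose there is a set of edges $F\subseteq E(G)$ that connects all terminal pairs and such that $F\subseteq E_t(\mathcal G)$ for all $t\in[\gamma]$, where $\gamma=n+2k$. Then there are pairwise temporally edge disjoint temporal walks $p_1,\dots,p_k$ such that $p_i$ connects $s_i$ to $z_i$ for every $i\in[k]$.
   Context: A temporal graph $\mathcal G=(G,\lambda)$ is a static graph $G$ with labeling $\lambda:E(G)\to 2^{\mathbb N^+}\setminus\{\emptyset\}$; edge $e$ is available at time steps $\lambda(e)$, and $E_t(\mathcal G)=\{e:t\in\lambda(e)\}$. A (strict) temporal walk is a sequence of time-vertices $(v_0,t_0),\dots,(v_r,t_r)$ with $t_0<\dots<t_r$ such that for each $i\in[r]$, $e=(v_{i-1},v_i)\in E(G)$ and $t_{i-1}\in\lambda(e)$; its time-edges are $((v_{i-1},v_i),t_{i-1})$. Two temporal walks are temporally edge disjoint if they share no time-edge. -}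

module Defs where

open import Data.Nat using (ℕ; _<_; _≤_; _+_; _*_)
open import Data.Fin using (Fin)
open import Data.Product using (_×_; _,_; Σ; ∃)
open import Data.Sum using (_⊎_)
open import Data.List using (List; []; _∷_)
open import Data.List.Membership.Propositional using (_∈_)
open import Relation.Binary.PropositionalEquality using (_≡_)
open import Relation.Binary.Construct.Closure.ReflexiveTransitive using (Star)
open import Relation.Nullary using (¬_)

record Graph (n : ℕ) : Set₁ where
  field
    Adj   : Fin n → Fin n → Set
    sym   : ∀ {u v} → Adj u v → Adj v u
    irrefl : ∀ {u} → ¬ Adj u u

-- A temporal graph: static graph G with a labeling λ assigning to every
-- edge a nonempty set of positive time steps.  λ u v t means
-- "t ∈ λ({u,v})"; it is symmetric since edges are unordered.
record TemporalGraph (n : ℕ) : Set₁ where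
  field
    G        : Graph n
    label    : Fin n → Fin n → ℕ → Set
    label-edge   : ∀ {u v t} → label u v t → Graph.Adj G u v
    label-sym   : ∀ {u v t} → label u v t → label v u t
    label-pos   : ∀ {u v t} → label u v t → 1 ≤ t
    label-nonempty : ∀ {u v} → Graph.Adj G u v → ∃ λ t → label u v t

module _ {n : ℕ} (𝒢 : TemporalGraph n) where
  open TemporalGraph 𝒢

  data TWalk : Fin n → ℕ → Fin n → Set where
    stay : ∀ {v t} → 1 ≤ t → TWalk v t v
    step : ∀ {u v z t t'} → label u v t → t < t' → TWalk v t' z → TWalk u t z

  timeEdges : ∀ {u t z} → TWalk u t z → List (Fin n × Fin n × ℕ)
  timeEdges (stay _) = []
  timeEdges (step {u} {v} {t = t} _ _ w) = (u , v , t) ∷ timeEdges w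

  Walk : Fin n → Fin n → Set
  Walk s z = Σ ℕ λ t → TWalk s t z

  walkTimeEdges : ∀ {s z} → Walk s z → List (Fin n × Fin n × ℕ)
  walkTimeEdges (_ , w) = timeEdges w

SameTimeEdge : ∀ {n} → (Fin n × Fin n × ℕ) → (Fin n × Fin n × ℕ) → Set
SameTimeEdge (u , v , t) (u' , v' , t') =
  t ≡ t' × ((u ≡ u' × v ≡ v') ⊎ (u ≡ v' × v ≡ u'))

TemporallyEdgeDisjoint : ∀ {n} (𝒢 : TemporalGraph n) {s z s' z' : Fin n} →
  Walk 𝒢 s z → Walk 𝒢 s' z' → Set
TemporallyEdgeDisjoint 𝒢 p q =
  ∀ {e e'} → e ∈ walkTimeEdges 𝒢 p → e' ∈ walkTimeEdges 𝒢 q → ¬ SameTimeEdge e e'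

record EdgeSubset {n : ℕ} (G : Graph n) : Set₁ where
  field
    F     : Fin n → Fin n → Set
    F⊆E   : ∀ {u v} → F u v → Graph.Adj G u v
    F-sym : ∀ {u v} → F u v → F v u

ConnectedIn : ∀ {n} {G : Graph n} → EdgeSubset G → Fin n → Fin n → Set
ConnectedIn F u v = Star (EdgeSubset.F F) u v

{-# OPTIONS --safe #-}
-- Restrict F to the finitely many edges of the given paths, so that adjacency becomes decidable
-- and breadth-first distances d can be computed.  In every component root a BFS tree at a vertex
-- r minimising S(r) = Σ_v d(r,v).  Such a median has eccentricity at most n/2: if p is the first
-- step of a geodesic from r to y, the d(r,y) vertices after r on it are closer to p than to r;
-- each of them gains a unit while every other vertex loses at most one, so
-- S(p) ≤ S(r) + n - 2 d(r,y), whence 2 d(r,y) ≤ n by minimality.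
-- Walk i climbs from s_i to the root and descends to z_i, crossing the tree edge between depths
-- m + 1 and m at time c_i - m on the way up and at time c_i + m + 1 on the way down, where
-- c_i = ⌊n/2⌋ + 2i; all these times lie in [1, n + 2k].  A time-edge used upwards by walk i and
-- downwards by walk j would give c_i - c_j = 2m + 1, and one used in the same direction by both
-- would give c_i = c_j; as the c_i are distinct and of equal parity, neither can happen.
module Submission where

open import Data.Fin using (Fin; zero; suc; toℕ)
open import Data.Fin.Properties using (any?; toℕ-injective; toℕ<n) renaming (_≟_ to _≟ᶠ_)
open import Data.List using (List; []; _∷_; allFin; filter)
open import Data.List.Extrema.Nat using (argmin; argmin-all; f[argmin]≤f[xs])
import Data.List.Membership.DecPropositional as DecMembership
open import Data.List.Membership.Propositional using (_∈_)
open import Data.List.Membership.Propositional.Properties using (∈-filter⁺; ∈-allFin)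
open import Data.List.Relation.Unary.All using (All; []; _∷_; lookup)
open import Data.List.Relation.Unary.All.Properties using (all-filter)
open import Data.List.Relation.Unary.Any using (here; there)
open import Data.Nat using (ℕ; zero; suc; _+_; _*_; _∸_; _⊓_; _≤_; _<_; _≤′_; ≤′-refl; ≤′-step; _≤?_; _<?_; z≤n; s≤s; ⌊_/2⌋)
open import Data.Nat.Properties
open import Data.Nat.Tactic.RingSolver using (solve-∀)
open import Data.Product using (Σ; ∃; _×_; _,_; proj₁; proj₂)
open import Data.Product.Properties using (≡-dec)
open import Data.Sum using (_⊎_; inj₁; inj₂; swap)
open import Function using (_∘_)
open import Level using (0ℓ)
open import Relation.Binary using (Rel; Symmetric; tri<; tri≈; tri>)
import Relation.Binary as B
open import Relation.Binary.Construct.Closure.ReflexiveTransitive using (Star; ε; _◅_; _◅◅_; reverse)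
import Relation.Binary.Construct.Closure.ReflexiveTransitive as Star
open import Relation.Binary.PropositionalEquality using (_≡_; _≢_; refl; sym; trans; cong; subst; subst₂)
open import Relation.Nullary using (¬_; Dec; yes; no; contradiction)
open import Relation.Nullary.Decidable using (_×-dec_; _⊎-dec_; ¬?; map′)
open import Relation.Unary using (Pred; Decidable; _⊆_)

open import Defs
open import Algebra.Properties.CommutativeMonoid.Sum +-0-commutativeMonoid using (sum; ∑-distrib-+)

∑-mono-≤ : ∀ {n} (f g : Fin n → ℕ) → (∀ i → f i ≤ g i) → sum f ≤ sum g
∑-mono-≤ {zero}  f g f≤g = z≤n
∑-mono-≤ {suc n} f g f≤g = +-mono-≤ (f≤g zero) (∑-mono-≤ (f ∘ suc) (g ∘ suc) (f≤g ∘ suc))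

∑-mono-< : ∀ {n} (f g : Fin n → ℕ) → (∀ i → f i ≤ g i) → ∀ w → f w < g w → sum f < sum g
∑-mono-< f g f≤g zero    fw<gw = +-mono-<-≤ fw<gw (∑-mono-≤ (f ∘ suc) (g ∘ suc) (f≤g ∘ suc))
∑-mono-< f g f≤g (suc w) fw<gw = +-mono-≤-< (f≤g zero) (∑-mono-< (f ∘ suc) (g ∘ suc) (f≤g ∘ suc) w fw<gw)

∑-1 : ∀ n → sum {n} (λ _ → 1) ≡ n
∑-1 zero    = refl
∑-1 (suc n) = cong suc (∑-1 n)

indicator : ∀ {P : Set} → Dec P → ℕ
indicator (yes _) = 1
indicator (no _)  = 0

indicator≤1 : ∀ {P : Set} (P? : Dec P) → indicator P? ≤ 1
indicator≤1 (yes _) = ≤-refl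
indicator≤1 (no _)  = z≤n

indicator-mono : ∀ {P Q : Set} (P? : Dec P) (Q? : Dec Q) → (P → Q) → indicator P? ≤ indicator Q?
indicator-mono (yes p) (yes _) _   = ≤-refl
indicator-mono (yes p) (no ¬q) P⇒Q = contradiction (P⇒Q p) ¬q
indicator-mono (no _)  Q?      _   = z≤n

indicator-< : ∀ {P Q : Set} (P? : Dec P) (Q? : Dec Q) → ¬ P → Q → indicator P? < indicator Q?
indicator-< (yes p) Q?      ¬p q = contradiction p ¬p
indicator-< (no _)  (yes _) ¬p q = ≤-refl
indicator-< (no _)  (no ¬q) ¬p q = contradiction q ¬q

count : ∀ {n} {P : Pred (Fin n) 0ℓ} → Decidable P → ℕ
count P? = sum (λ v → indicator (P? v))

count≤n : ∀ {n} {P : Pred (Fin n) 0ℓ} (P? : Decidable P) → count P? ≤ n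
count≤n {n} P? = ≤-trans (∑-mono-≤ _ _ (λ v → indicator≤1 (P? v))) (≤-reflexive (∑-1 n))

module _ {n} {P Q : Pred (Fin n) 0ℓ} (P? : Decidable P) (Q? : Decidable Q) where

  count-mono : P ⊆ Q → count P? ≤ count Q?
  count-mono P⊆Q = ∑-mono-≤ _ _ (λ v → indicator-mono (P? v) (Q? v) P⊆Q)

  count-< : P ⊆ Q → ∀ {w} → Q w → ¬ P w → count P? < count Q?
  count-< P⊆Q {w} qw ¬pw =
    ∑-mono-< _ _ (λ v → indicator-mono (P? v) (Q? v) P⊆Q) w (indicator-< (P? w) (Q? w) ¬pw qw)

count-strictChain : ∀ {n} {B : ℕ → Pred (Fin n) 0ℓ} (B? : ∀ j → Decidable (B j)) →
  (∀ j → B j ⊆ B (suc j)) → ∀ m → (∀ j → j < m → ∃ λ v → B (suc j) v × ¬ B j v) → m ≤ count (B? m)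
count-strictChain B? B-mono zero    fresh = z≤n
count-strictChain B? B-mono (suc m) fresh with fresh m ≤-refl
... | v , new , ¬old = ≤-trans (s≤s (count-strictChain B? B-mono m (λ j j<m → fresh j (m<n⇒m<1+n j<m))))
                                (count-< (B? m) (B? (suc m)) (B-mono m) new ¬old)

least : ∀ {P : ℕ → Set} → (∀ j → Dec (P j)) → ℕ → ℕ
least P? zero = zero
least P? (suc N) with P? zero
... | yes _ = zero
... | no _  = suc (least (P? ∘ suc) N)

least≤N : ∀ {P : ℕ → Set} (P? : ∀ j → Dec (P j)) N → least P? N ≤ N
least≤N P? zero = z≤n
least≤N P? (suc N) with P? zero
... | yes _ = z≤n
... | no _  = s≤s (least≤N (P? ∘ suc) N)

least-≤ : ∀ {P : ℕ → Set} (P? : ∀ j → Dec (P j)) N {j} → P j → least P? N ≤ j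
least-≤ P? zero    pj = z≤n
least-≤ P? (suc N) {j} pj with P? zero
least-≤ P? (suc N) {j}     pj | yes _  = z≤n
least-≤ P? (suc N) {zero}  pj | no ¬p0 = contradiction pj ¬p0
least-≤ P? (suc N) {suc j} pj | no _   = s≤s (least-≤ (P? ∘ suc) N pj)

least-sound : ∀ {P : ℕ → Set} (P? : ∀ j → Dec (P j)) N → P N → P (least P? N)
least-sound P? zero    pN = pN
least-sound P? (suc N) pN with P? zero
... | yes p0 = p0
... | no _   = least-sound (P? ∘ suc) N pN

least-none : ∀ {P : ℕ → Set} (P? : ∀ j → Dec (P j)) N → (∀ j → ¬ P j) → least P? N ≡ N
least-none P? zero    ¬P = refl
least-none P? (suc N) ¬P with P? zero
... | yes p0 = contradiction p0 (¬P zero)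
... | no _   = cong suc (least-none (P? ∘ suc) N (¬P ∘ suc))

<-suc-extend : ∀ {L : ℕ → Set} {e} → (∀ j → j < e → L j) → L e → ∀ j → j < suc e → L j
<-suc-extend below top j (s≤s j≤e) with m≤n⇒m<n∨m≡n j≤e
... | inj₁ j<e  = below j j<e
... | inj₂ refl = top

lex-< : ∀ {n a b x y} → a < n → x < y → a + n * x < b + n * y
lex-< {n} {a} {b} {x} {y} a<n x<y = begin-strict
  a + n * x   <⟨ +-monoˡ-< (n * x) a<n ⟩
  n + n * x   ≡⟨ *-suc n x ⟨
  n * suc x   ≤⟨ *-monoʳ-≤ n x<y ⟩
  n * y       ≤⟨ m≤n+m (n * y) b ⟩
  b + n * y   ∎
  where open ≤-Reasoning

⌊n/2⌋+⌊n/2⌋≤n : ∀ n → ⌊ n /2⌋ + ⌊ n /2⌋ ≤ n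
⌊n/2⌋+⌊n/2⌋≤n n = ≤-trans (+-monoʳ-≤ ⌊ n /2⌋ (⌊n/2⌋≤⌈n/2⌉ n)) (≤-reflexive (⌊n/2⌋+⌈n/2⌉≡n n))

m+m≤n⇒m≤⌊n/2⌋ : ∀ {m n} → m + m ≤ n → m ≤ ⌊ n /2⌋
m+m≤n⇒m≤⌊n/2⌋ {m} m+m≤n = subst (_≤ _) (sym (n≡⌊n+n/2⌋ m)) (⌊n/2⌋-mono m+m≤n)

m≡ℓ∧n≡1+ℓ⇒m⊓n≡ℓ : ∀ {m n ℓ} → m ≡ ℓ → n ≡ suc ℓ → m ⊓ n ≡ ℓ
m≡ℓ∧n≡1+ℓ⇒m⊓n≡ℓ refl refl = m≤n⇒m⊓n≡m (n≤1+n _)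

-- Distances in a finite graph

record Forest {n} (E : Rel (Fin n) 0ℓ) : Set where
  field
    root       : Fin n → Fin n
    depth      : Fin n → ℕ
    root-cong  : ∀ {x y} → Star E x y → root x ≡ root y
    depth-zero : ∀ {v} → depth v ≡ 0 → root v ≡ v
    parent     : ∀ {v d} → depth v ≡ suc d → ∃ λ u → E u v × depth u ≡ d

module FiniteGraph {n} {E : Rel (Fin n) 0ℓ} (E? : B.Decidable E) (E-sym : Symmetric E) where

  Ball : ℕ → Fin n → Pred (Fin n) 0ℓ
  Ball zero    x v = x ≡ v
  Ball (suc j) x v = Ball j x v ⊎ ∃ λ u → Ball j x u × E u v

  ball? : ∀ j x → Decidable (Ball j x)
  ball? zero    x v = x ≟ᶠ v
  ball? (suc j) x v = ball? j x v ⊎-dec any? (λ u → ball? j x u ×-dec E? u v)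

  Ball-mono : ∀ {i j x} → i ≤′ j → Ball i x ⊆ Ball j x
  Ball-mono ≤′-refl        b = b
  Ball-mono (≤′-step i≤j) b = inj₁ (Ball-mono i≤j b)

  Ball-prepend : ∀ {j w x v} → E w x → Ball j x v → Ball (suc j) w v
  Ball-prepend {zero}  ewx refl                 = inj₂ (_ , refl , ewx)
  Ball-prepend {suc j} ewx (inj₁ b)             = inj₁ (Ball-prepend ewx b)
  Ball-prepend {suc j} ewx (inj₂ (u , b , euv)) = inj₂ (u , Ball-prepend ewx b , euv)

  Ball⇒Star : ∀ {j x v} → Ball j x v → Star E x v
  Ball⇒Star {zero}  refl                 = ε
  Ball⇒Star {suc j} (inj₁ b)             = Ball⇒Star b
  Ball⇒Star {suc j} (inj₂ (u , b , euv)) = Ball⇒Star b ◅◅ (euv ◅ ε)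

  Saturated : ℕ → Fin n → Set
  Saturated j x = Ball (suc j) x ⊆ Ball j x

  saturated-suc : ∀ {j x} → Saturated j x → Saturated (suc j) x
  saturated-suc sat (inj₁ b)             = b
  saturated-suc sat (inj₂ (u , b , euv)) = inj₂ (u , sat b , euv)

  saturated-upward : ∀ {i j x} → i ≤′ j → Saturated i x → Saturated j x
  saturated-upward ≤′-refl        sat = sat
  saturated-upward (≤′-step i≤j) sat = saturated-suc (saturated-upward i≤j sat)

  -- Every unsaturated step adds a vertex, and there are only n vertices.
  saturated : ∀ x → Saturated n x
  saturated x {v} b with ball? n x v
  ... | yes b′ = b′
  ... | no ¬b  = contradiction (count-strictChain (λ j → ball? j x) (λ j → inj₁) (suc n) growth)
                               (<⇒≱ (s≤s (count≤n (ball? (suc n) x))))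
    where
    growth : ∀ j → j < suc n → ∃ λ w → Ball (suc j) x w × ¬ Ball j x w
    growth j (s≤s j≤n) with any? (λ w → ball? (suc j) x w ×-dec ¬? (ball? j x w))
    ... | yes new = new
    ... | no none = contradiction (saturated-upward (≤⇒≤′ j≤n) sat b) ¬b
      where
      sat : Saturated j x
      sat {w} b′ with ball? j x w
      ... | yes old = old
      ... | no ¬old = contradiction (w , b′ , ¬old) none

  Star⇒Ball : ∀ {x v} → Star E x v → Ball n x v
  Star⇒Ball ε          = Ball-mono (≤⇒≤′ z≤n) refl
  Star⇒Ball (exy ◅ yv) = saturated _ (Ball-prepend exy (Star⇒Ball yv))

  connected? : B.Decidable (Star E)
  connected? x v = map′ Ball⇒Star Star⇒Ball (ball? n x v)

  dist : Fin n → Fin n → ℕ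
  dist x v = least (λ j → ball? j x v) n

  dist≤n : ∀ x v → dist x v ≤ n
  dist≤n x v = least≤N (λ j → ball? j x v) n

  dist-≤ : ∀ {j x v} → Ball j x v → dist x v ≤ j
  dist-≤ {x = x} {v} = least-≤ (λ j → ball? j x v) n

  dist-ball : ∀ {x v} → Star E x v → Ball (dist x v) x v
  dist-ball {x} {v} xv = least-sound (λ j → ball? j x v) n (Star⇒Ball xv)

  dist-disconnected : ∀ {x v} → ¬ Star E x v → dist x v ≡ n
  dist-disconnected {x} {v} ¬xv = least-none (λ j → ball? j x v) n (λ j → ¬xv ∘ Ball⇒Star)

  dist-≤-disconnected : ∀ {x u} → ¬ Star E x u → ∀ y v → dist y v ≤ dist x u
  dist-≤-disconnected ¬xu y v = subst (dist y v ≤_) (sym (dist-disconnected ¬xu)) (dist≤n y v)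

  dist-refl : ∀ x → dist x x ≡ 0
  dist-refl x = n≤0⇒n≡0 (dist-≤ {0} refl)

  dist≡0⇒≡ : ∀ {x v} → Star E x v → dist x v ≡ 0 → x ≡ v
  dist≡0⇒≡ xv d≡0 = subst (λ j → Ball j _ _) d≡0 (dist-ball xv)

  dist-stepʳ : ∀ {x u v} → E u v → dist x v ≤ suc (dist x u)
  dist-stepʳ {x} {u} {v} euv with connected? x u
  ... | yes xu = dist-≤ (inj₂ (u , dist-ball xu , euv))
  ... | no ¬xu = m≤n⇒m≤1+n (dist-≤-disconnected ¬xu x v)

  dist-stepˡ : ∀ {w x v} → E w x → dist w v ≤ suc (dist x v)
  dist-stepˡ {w} {x} {v} ewx with connected? x v
  ... | yes xv = dist-≤ (Ball-prepend ewx (dist-ball xv))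
  ... | no ¬xv = m≤n⇒m≤1+n (dist-≤-disconnected ¬xv w v)

  dist-predecessor : ∀ {x v e} → Star E x v → dist x v ≡ suc e → ∃ λ u → E u v × dist x u ≡ e
  dist-predecessor {x} {v} {e} xv d≡ with subst (λ j → Ball j x v) d≡ (dist-ball xv)
  ... | inj₁ b             = contradiction (subst (_≤ e) d≡ (dist-≤ b)) 1+n≰n
  ... | inj₂ (u , b , euv) =
    u , euv , ≤-antisym (dist-≤ b) (≤-pred (subst (_≤ suc (dist x u)) d≡ (dist-stepʳ euv)))

  -- Median vertices

  totalDist : Fin n → ℕ
  totalDist x = sum (dist x)

  geodesic : ∀ {r y e} → Star E r y → dist r y ≡ suc e →
    ∃ λ p → E r p × dist p y ≤ e × (∀ j → j < e → ∃ λ q → dist r q ≡ suc j × dist p q ≤ j)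
  geodesic {r} {y} {zero} ry d≡ with dist-predecessor ry d≡
  ... | u , euy , d≡0 with dist≡0⇒≡ (ry ◅◅ (E-sym euy ◅ ε)) d≡0
  ... | refl = y , euy , ≤-reflexive (dist-refl y) , λ _ ()
  geodesic {r} {y} {suc e} ry d≡ with dist-predecessor ry d≡
  ... | u , euy , du≡ with geodesic (ry ◅◅ (E-sym euy ◅ ε)) du≡
  ... | p , erp , dpu≤e , below =
    p , erp , ≤-trans (dist-stepʳ euy) (s≤s dpu≤e) , <-suc-extend below (u , du≡ , dpu≤e)

  module Exchange {r p} (erp : E r p) where

    Closer : Pred (Fin n) 0ℓ
    Closer v = dist p v < dist r v

    closer? : Decidable Closer
    closer? v = dist p v <? dist r v

    totalDist-exchange : totalDist p + (count closer? + count closer?) ≤ totalDist r + n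
    totalDist-exchange = begin
      totalDist p + (count closer? + count closer?)
        ≡⟨ cong (totalDist p +_) (∑-distrib-+ (indicator ∘ closer?) (indicator ∘ closer?)) ⟨
      totalDist p + sum (λ v → indicator (closer? v) + indicator (closer? v))
        ≡⟨ ∑-distrib-+ (dist p) _ ⟨
      sum (λ v → dist p v + (indicator (closer? v) + indicator (closer? v)))
        ≤⟨ ∑-mono-≤ _ _ pointwise ⟩
      sum (λ v → dist r v + 1)
        ≡⟨ ∑-distrib-+ (dist r) _ ⟩
      totalDist r + sum {n} (λ _ → 1)
        ≡⟨ cong (totalDist r +_) (∑-1 n) ⟩
      totalDist r + n ∎
      where
      open ≤-Reasoning
      pointwise : ∀ v → dist p v + (indicator (closer? v) + indicator (closer? v)) ≤ dist r v + 1
      pointwise v with closer? v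
      ... | yes closer = subst (_≤ dist r v + 1) (sym (+-suc (dist p v) 1)) (+-monoˡ-≤ 1 closer)
      ... | no _       = begin
        dist p v + 0      ≡⟨ +-identityʳ (dist p v) ⟩
        dist p v          ≤⟨ dist-stepˡ (E-sym erp) ⟩
        suc (dist r v)    ≡⟨ +-comm 1 (dist r v) ⟩
        dist r v + 1      ∎

  eccentricity-bound : ∀ {r} → (∀ {p} → E r p → totalDist r ≤ totalDist p) →
    ∀ {y} → Star E r y → dist r y + dist r y ≤ n
  eccentricity-bound {r} locally-minimal {y} ry with dist r y in d≡
  ... | zero  = z≤n
  ... | suc e with geodesic ry d≡
  ... | p , erp , dpy≤e , below = begin
    suc e + suc e                  ≤⟨ +-mono-≤ closers closers ⟩
    count closer? + count closer?  ≤⟨ +-cancelˡ-≤ (totalDist p) _ _ exchange ⟩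
    n                              ∎
    where
    open Exchange erp
    open ≤-Reasoning

    exchange : totalDist p + (count closer? + count closer?) ≤ totalDist p + n
    exchange = ≤-trans totalDist-exchange (+-monoˡ-≤ n (locally-minimal erp))

    Layer : ℕ → Pred (Fin n) 0ℓ
    Layer j v = Closer v × dist r v ≤ j

    layer? : ∀ j → Decidable (Layer j)
    layer? j v = closer? v ×-dec (dist r v ≤? j)

    fresh : ∀ j → j < suc e → ∃ λ q → Layer (suc j) q × ¬ Layer j q
    fresh j j<1+e with <-suc-extend below (y , d≡ , dpy≤e) j j<1+e
    ... | q , drq≡ , dpq≤j =
      q , (subst (dist p q <_) (sym drq≡) (s≤s dpq≤j) , ≤-reflexive drq≡) ,
      λ (_ , drq≤j) → 1+n≰n (subst (_≤ j) drq≡ drq≤j)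

    closers : suc e ≤ count closer?
    closers = ≤-trans (count-strictChain layer? (λ j (c , le) → c , m≤n⇒m≤1+n le) (suc e) fresh)
                      (count-mono (layer? (suc e)) closer? proj₁)

  -- Breaking ties by the index makes the minimiser, hence the root, depend only on the component.
  rank : Fin n → ℕ
  rank v = toℕ v + n * totalDist v

  rank-injective : ∀ {u v} → rank u ≡ rank v → u ≡ v
  rank-injective {u} {v} eq with <-cmp (totalDist u) (totalDist v)
  ... | tri< lt _ _  = contradiction eq (<⇒≢ (lex-< (toℕ<n u) lt))
  ... | tri> _ _ gt  = contradiction (sym eq) (<⇒≢ (lex-< (toℕ<n v) gt))
  ... | tri≈ _ eq′ _ = toℕ-injective (+-cancelʳ-≡ (n * totalDist v) (toℕ u) (toℕ v)
                         (subst (λ s → toℕ u + n * s ≡ rank v) eq′ eq))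

  rank-≤⇒totalDist-≤ : ∀ {u v} → rank u ≤ rank v → totalDist u ≤ totalDist v
  rank-≤⇒totalDist-≤ {u} {v} le = ≮⇒≥ (λ gt → <⇒≱ (lex-< (toℕ<n v) gt) le)

  root : Fin n → Fin n
  root x = argmin rank x (filter (connected? x) (allFin n))

  root-connected : ∀ x → Star E x (root x)
  root-connected x = argmin-all rank ε (all-filter (connected? x) (allFin n))

  from-root : ∀ v → Star E (root v) v
  from-root v = reverse E-sym (root-connected v)

  root-minimal : ∀ {x v} → Star E x v → rank (root x) ≤ rank v
  root-minimal {x} {v} xv = lookup (f[argmin]≤f[xs] {f = rank} x (filter (connected? x) (allFin n)))
                                   (∈-filter⁺ (connected? x) (∈-allFin v) xv)

  root-cong : ∀ {x y} → Star E x y → root x ≡ root y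
  root-cong {x} {y} xy = rank-injective (≤-antisym (root-minimal (xy ◅◅ root-connected y))
                                                   (root-minimal (reverse E-sym xy ◅◅ root-connected x)))

  root-locally-minimal : ∀ {x p} → E (root x) p → totalDist (root x) ≤ totalDist p
  root-locally-minimal {x} erp = rank-≤⇒totalDist-≤ (root-minimal (root-connected x ◅◅ (erp ◅ ε)))

  medianForest : Forest E
  medianForest = record
    { root       = root
    ; depth      = depth
    ; root-cong  = root-cong
    ; depth-zero = λ {v} → dist≡0⇒≡ (from-root v)
    ; parent     = parent
    }
    where
    depth : Fin n → ℕ
    depth v = dist (root v) v

    parent : ∀ {v d} → depth v ≡ suc d → ∃ λ u → E u v × depth u ≡ d
    parent {v} d≡ with dist-predecessor (from-root v) d≡
    ... | u , euv , du≡ = u , euv , trans (cong (λ r → dist r u) (root-cong (euv ◅ ε))) du≡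

  medianForest-shallow : ∀ v → Forest.depth medianForest v + Forest.depth medianForest v ≤ n
  medianForest-shallow v = eccentricity-bound root-locally-minimal (from-root v)

edges : ∀ {A : Set} {R : Rel A 0ℓ} {x y} → Star R x y → List (A × A)
edges ε                 = []
edges (_◅_ {x} {y} _ q) = (x , y) ∷ edges q

edges-sound : ∀ {A : Set} {R : Rel A 0ℓ} {x y u v} (q : Star R x y) → (u , v) ∈ edges q → R u v
edges-sound (r ◅ q) (here refl) = r
edges-sound (r ◅ q) (there m)   = edges-sound q m

edges-cover : ∀ {A : Set} {R : Rel A 0ℓ} {x y} (q : Star R x y) → Star (λ u v → (u , v) ∈ edges q) x y
edges-cover ε       = ε
edges-cover (r ◅ q) = here refl ◅ Star.map there (edges-cover q)

module PathSupport {n k} {R : Rel (Fin n) 0ℓ} (R-sym : Symmetric R)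
  {s z : Fin k → Fin n} (paths : ∀ i → Star R (s i) (z i)) where

  open DecMembership (≡-dec (_≟ᶠ_ {n}) (_≟ᶠ_ {n})) using (_∈?_)

  Support : Rel (Fin n) 0ℓ
  Support u v = ∃ λ i → (u , v) ∈ edges (paths i) ⊎ (v , u) ∈ edges (paths i)

  support? : B.Decidable Support
  support? u v = any? (λ i → ((u , v) ∈? edges (paths i)) ⊎-dec ((v , u) ∈? edges (paths i)))

  support-sym : Symmetric Support
  support-sym (i , m) = i , swap m

  support⊆R : ∀ {u v} → Support u v → R u v
  support⊆R (i , inj₁ m) = edges-sound (paths i) m
  support⊆R (i , inj₂ m) = R-sym (edges-sound (paths i) m)

  support-connects : ∀ i → Star Support (s i) (z i)
  support-connects i = Star.map (λ m → i , inj₁ m) (edges-cover (paths i))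

-- Timed routes through the root of a forest

-- A route with key c crosses an edge between depths m + 1 and m at time c - m towards the root
-- and at time c + m + 1 away from it; m is read off with ⊓, so orientation does not matter.
Compatible : ℕ → ℕ → ℕ → Set
Compatible c m t = t + m ≡ c ⊎ t ≡ suc (m + c)

Crossing : ∀ {n} → (Fin n → ℕ) → ℕ → Fin n × Fin n × ℕ → Set
Crossing depth c (u , v , t) = Compatible c (depth u ⊓ depth v) t

inward≢outward : ∀ {h i j m t} → t + m ≡ h + 2 * i → t ≢ suc (m + (h + 2 * j))
inward≢outward {h} {i} {j} {m} {t} inward refl =
  even≢odd i (m + j) (+-cancelˡ-≡ h _ _ (trans (sym inward) (arith m h j)))
  where
  arith : ∀ m h j → suc (m + (h + 2 * j)) + m ≡ h + suc (2 * (m + j))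
  arith = solve-∀

compatible-unique : ∀ {h i j m t} → Compatible (h + 2 * i) m t → Compatible (h + 2 * j) m t → i ≡ j
compatible-unique {h} {i} {j} (inj₁ a) (inj₁ b) =
  *-cancelˡ-≡ i j 2 (+-cancelˡ-≡ h _ _ (trans (sym a) b))
compatible-unique {h} {i} {j} {m} (inj₂ a) (inj₂ b) =
  *-cancelˡ-≡ i j 2 (+-cancelˡ-≡ h _ _ (+-cancelˡ-≡ m _ _ (suc-injective (trans (sym a) b))))
compatible-unique {h} {i} {j} (inj₁ a) (inj₂ b) = contradiction b (inward≢outward {h} {i} {j} a)
compatible-unique {h} {i} {j} (inj₂ a) (inj₁ b) = contradiction a (inward≢outward {h} {j} {i} b)

crossing-unique : ∀ {n} (depth : Fin n → ℕ) {h i j e e′} →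
  Crossing depth (h + 2 * i) e → Crossing depth (h + 2 * j) e′ → SameTimeEdge e e′ → i ≡ j
crossing-unique depth {h} cr cr′ (refl , inj₁ (refl , refl)) = compatible-unique {h} cr cr′
crossing-unique depth {h} {e = u , v , t} cr cr′ (refl , inj₂ (refl , refl)) =
  compatible-unique {h} cr (subst (λ m → Compatible _ m t) (⊓-comm (depth v) (depth u)) cr′)

module Routes {n} (𝒢 : TemporalGraph n) {E : Rel (Fin n) 0ℓ} (Φ : Forest E) {T H c : ℕ}
  (available : ∀ {u v} → E u v → ∀ t → 1 ≤ t → t ≤ T → TemporalGraph.label 𝒢 u v t)
  (shallow : ∀ v → Forest.depth Φ v ≤ H) (H≤c : H ≤ c) (H+c≤T : H + c ≤ T) where

  open Forest Φ
  open TemporalGraph 𝒢 using (label; label-sym)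

  Route : Fin n → ℕ → Fin n → Set
  Route x t z = Σ (TWalk 𝒢 x t z) λ w → All (Crossing depth c) (timeEdges 𝒢 w)

  descent : ∀ ℓ {v z} → depth v ≡ ℓ → Route v (suc (ℓ + c)) z → Route (root v) (suc c) z
  descent zero    {v} d≡0 r = subst (λ x → Route x (suc c) _) (sym (depth-zero d≡0)) r
  descent (suc ℓ) {v} d≡  (w , crossings) with parent d≡
  ... | u , euv , du≡ = subst (λ x → Route x (suc c) _) (root-cong (euv ◅ ε))
                              (descent ℓ du≡ (step available-uv ≤-refl w , crossing ∷ crossings))
    where
    available-uv : label u v (suc (ℓ + c))
    available-uv = available euv _ (s≤s z≤n)
                     (≤-trans (+-monoˡ-≤ c (subst (_≤ H) d≡ (shallow v))) H+c≤T)

    crossing : Compatible c (depth u ⊓ depth v) (suc (ℓ + c))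
    crossing = inj₂ (cong (λ m → suc (m + c)) (sym (m≡ℓ∧n≡1+ℓ⇒m⊓n≡ℓ du≡ d≡)))

  ascent : ∀ ℓ {v z τ} → depth v ≡ ℓ → τ + ℓ ≡ suc c → Route (root v) (suc c) z → Route v τ z
  ascent zero    {v} {τ = τ} d≡0 τ≡ r =
    subst₂ (λ x t → Route x t _) (depth-zero d≡0) (trans (sym τ≡) (+-identityʳ τ)) r
  ascent (suc ℓ) {v} {τ = τ} d≡ τ≡ r with parent d≡
  ... | u , euv , du≡ with ascent ℓ du≡ (trans (sym (+-suc τ ℓ)) τ≡)
                                        (subst (λ x → Route x (suc c) _) (sym (root-cong (euv ◅ ε))) r)
  ... | w , crossings = step available-vu ≤-refl w , crossing ∷ crossings
    where
    τ+ℓ≡c : τ + ℓ ≡ c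
    τ+ℓ≡c = suc-injective (trans (sym (+-suc τ ℓ)) τ≡)

    1≤τ : 1 ≤ τ
    1≤τ = +-cancelʳ-≤ ℓ 1 τ (≤-trans (subst (_≤ H) d≡ (shallow v)) (≤-trans H≤c (≤-reflexive (sym τ+ℓ≡c))))

    available-vu : label v u τ
    available-vu = label-sym (available euv τ 1≤τ
                     (≤-trans (≤-trans (m≤m+n τ ℓ) (≤-reflexive τ+ℓ≡c)) (≤-trans (m≤n+m c H) H+c≤T)))

    crossing : Compatible c (depth v ⊓ depth u) τ
    crossing = inj₁ (trans (cong (τ +_) (trans (⊓-comm (depth v) (depth u)) (m≡ℓ∧n≡1+ℓ⇒m⊓n≡ℓ du≡ d≡))) τ+ℓ≡c)

  route : ∀ {x z} → Star E x z → Σ (Walk 𝒢 x z) λ p → All (Crossing depth c) (walkTimeEdges 𝒢 p)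
  route {x} {z} xz = (suc c ∸ depth x , proj₁ r) , proj₂ r
    where
    r : Route x (suc c ∸ depth x) z
    r = ascent (depth x) refl (m∸n+n≡m (≤-trans (shallow x) (≤-trans H≤c (n≤1+n c))))
          (subst (λ x → Route x (suc c) z) (sym (root-cong xz))
            (descent (depth z) refl (stay (s≤s z≤n) , [])))

mainTheorem4 : (n k : ℕ) (𝒢 : TemporalGraph n) (s z : Fin k → Fin n)
    (F : EdgeSubset (TemporalGraph.G 𝒢)) →
    (∀ i → ConnectedIn F (s i) (z i)) →
    (∀ {u v} → EdgeSubset.F F u v → ∀ t → 1 ≤ t → t ≤ n + 2 * k → TemporalGraph.label 𝒢 u v t) →
    Σ ((i : Fin k) → Walk 𝒢 (s i) (z i)) λ p →
    ∀ i j → i ≢ j → TemporallyEdgeDisjoint 𝒢 (p i) (p j)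
mainTheorem4 n k 𝒢 s z F connects available = proj₁ ∘ routes , disjoint
  where
  open PathSupport (EdgeSubset.F-sym F) connects
  open FiniteGraph support? support-sym using (medianForest; medianForest-shallow)
  open Forest medianForest using (depth)

  H = ⌊ n /2⌋

  key : Fin k → ℕ
  key i = H + 2 * toℕ i

  H+key≤n+2k : ∀ i → H + key i ≤ n + 2 * k
  H+key≤n+2k i = subst (_≤ n + 2 * k) (+-assoc H H (2 * toℕ i))
                   (+-mono-≤ (⌊n/2⌋+⌊n/2⌋≤n n) (*-monoʳ-≤ 2 (<⇒≤ (toℕ<n i))))

  routes : ∀ i → Σ (Walk 𝒢 (s i) (z i)) λ p → All (Crossing depth (key i)) (walkTimeEdges 𝒢 p)
  routes i = Routes.route 𝒢 medianForest (λ e → available (support⊆R e))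
               (m+m≤n⇒m≤⌊n/2⌋ ∘ medianForest-shallow) (m≤m+n H _) (H+key≤n+2k i) (support-connects i)

  disjoint : ∀ i j → i ≢ j → TemporallyEdgeDisjoint 𝒢 (proj₁ (routes i)) (proj₁ (routes j))
  disjoint i j i≢j e∈ e′∈ same = i≢j (toℕ-injective
    (crossing-unique depth {H} (lookup (proj₂ (routes i)) e∈) (lookup (proj₂ (routes j)) e′∈) same))
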